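{- Let $2k+1$ be a prime, let $p\ge 2$ and let $n_1,\dots,n_p$ be positive integers. The complete multipartite graph $K_{n_1,n_2,\dots,n_p}$ admits a $(2k+1)$-neighborhood balanced coloring if and only if $n_i\equiv 0\pmod{2k+1}$ for every $i=1,2,\dots,p$.
   Context: For a prime $2k+1$ (with $k\ge 1$), a $(2k+1)$-neighborhood balanced coloring of a finite simple graph $G$ is an assignment to each vertex of one of $2k+1$ colors $R_1,\dots,R_{2k+1}$ such that every vertex has an equal number of neighbors of each color. $K_{n_1,\dots,n_p}$ is the complete multipartite graph with partite sets of sizes $n_1,\dots,n_p$. -}

module Defs where

open import Data.Nat using (ℕ; zero; suc; _+_; _*_)
open import Data.Fin using (Fin; zero; suc)
open import Data.Fin.Properties using (_≟_)
open import Data.Product using (Σ; _,_; proj₁)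
open import Relation.Nullary using (Dec; yes; no; ¬_)
open import Relation.Binary.PropositionalEquality using (_≡_)

count : (m : ℕ) → {P : Fin m → Set} → ((x : Fin m) → Dec (P x)) → ℕ
count zero    P? = 0
count (suc m) P? with P? zero
... | yes _ = suc (count m (λ x → P? (suc x)))
... | no  _ = count m (λ x → P? (suc x))

Vertex : (p : ℕ) → (Fin p → ℕ) → Set
Vertex p n = Σ (Fin p) (λ i → Fin (n i))

Adj : (p : ℕ) (n : Fin p → ℕ) → Vertex p n → Vertex p n → Set
Adj p n (i , _) (j , _) = ¬ (i ≡ j)

adj? : (p : ℕ) (n : Fin p → ℕ) → (u v : Vertex p n) → Dec (Adj p n u v)
adj? p n (i , _) (j , _) with i ≟ j
... | yes e = no (λ f → f e)
... | no ne = yes ne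

sumFin : (m : ℕ) → (Fin m → ℕ) → ℕ
sumFin zero    f = 0
sumFin (suc m) f = f zero + sumFin m (λ x → f (suc x))

nbrsOfColour : (p : ℕ) (n : Fin p → ℕ) (q : ℕ) → (Vertex p n → Fin q) →
               Vertex p n → Fin q → ℕ
nbrsOfColour p n q col v c =
  sumFin p (λ j → count (n j) (λ b → decBoth (adj? p n v (j , b)) (col (j , b) ≟ c)))
  where
  decBoth : {A B : Set} → Dec A → Dec B → Dec (Σ A (λ _ → B))
  decBoth (yes a) (yes b) = yes (a , b)
  decBoth (yes a) (no nb) = no (λ x → nb (Data.Product.proj₂ x))
  decBoth (no na) _       = no (λ x → na (proj₁ x))

IsNBColouring : (p : ℕ) (n : Fin p → ℕ) (q : ℕ) → (Vertex p n → Fin q) → Set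
IsNBColouring p n q col =
  (v : Vertex p n) (c c′ : Fin q) → nbrsOfColour p n q col v c ≡ nbrsOfColour p n q col v c′

HasNBColouring : (p : ℕ) (n : Fin p → ℕ) (q : ℕ) → Set
HasNBColouring p n q = Σ (Vertex p n → Fin q) (IsNBColouring p n q)

-- In K_{n_1,…,n_p} a vertex of part i sees every vertex outside part i, so
-- its number of neighbours of colour c is T c − C i c, where T c counts all
-- vertices of colour c and C i c those in part i. Summing over one vertex
-- per part, (p − 1) T c is independent of c, hence (p ≥ 2) so is T c, and
-- then so is every C i c: each part is split evenly among the colours,
-- i.e. q ∣ n_i. Conversely, colouring every part evenly gives a balanced
-- colouring.
module Submission where

open import Defs
open import Data.Nat using (ℕ; zero; suc; _+_; _*_; _≤_; s≤s; z≤n)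
open import Data.Nat.Properties
  using (+-comm; +-assoc; *-comm; *-zeroʳ; +-cancelˡ-≡; +-cancelʳ-≡; *-cancelˡ-≡; +-commutativeSemigroup)
open import Data.Nat.Divisibility using (_∣_; divides)
open import Data.Nat.Primality using (Prime)
open import Data.Fin using (Fin; zero; suc; _↑ˡ_; _↑ʳ_; splitAt; fromℕ<)
open import Data.Fin.Properties using (_≟_; suc-injective; splitAt-↑ˡ; splitAt-↑ʳ)
open import Data.Product using (Σ; _,_; proj₁; proj₂)
open import Data.Sum using ([_,_]′)
open import Data.Bool using (if_then_else_)
open import Data.Empty using (⊥-elim)
open import Relation.Nullary using (Dec; yes; no; ¬_; does)
open import Relation.Binary.PropositionalEquality
  using (_≡_; refl; sym; trans; cong; cong₂; module ≡-Reasoning)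
open import Function.Bundles using (_⇔_; mk⇔)
open import Algebra.Properties.CommutativeSemigroup +-commutativeSemigroup
  using (interchange)

sumFin-cong : ∀ m {f g : Fin m → ℕ} → (∀ x → f x ≡ g x) → sumFin m f ≡ sumFin m g
sumFin-cong zero    f≡g = refl
sumFin-cong (suc m) f≡g = cong₂ _+_ (f≡g zero) (sumFin-cong m (λ x → f≡g (suc x)))

sumFin-+ : ∀ m (f g : Fin m → ℕ) → sumFin m (λ x → f x + g x) ≡ sumFin m f + sumFin m g
sumFin-+ zero    f g = refl
sumFin-+ (suc m) f g =
  trans (cong (f zero + g zero +_) (sumFin-+ m (λ x → f (suc x)) (λ x → g (suc x))))
        (interchange (f zero) (g zero) _ _)

sumFin-const : ∀ m d → sumFin m (λ _ → d) ≡ m * d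
sumFin-const zero    d = refl
sumFin-const (suc m) d = cong (d +_) (sumFin-const m d)

sumFin-swap : ∀ m k (f : Fin m → Fin k → ℕ) →
  sumFin m (λ x → sumFin k (f x)) ≡ sumFin k (λ y → sumFin m (λ x → f x y))
sumFin-swap zero    k f = sym (trans (sumFin-const k 0) (*-zeroʳ k))
sumFin-swap (suc m) k f =
  trans (cong (sumFin k (f zero) +_) (sumFin-swap m k (λ x → f (suc x))))
        (sym (sumFin-+ k (f zero) (λ y → sumFin m (λ x → f (suc x) y))))

sumFin-+-missing : ∀ m (i : Fin m) {g h : Fin m → ℕ} →
  (∀ j → ¬ i ≡ j → g j ≡ h j) → g i ≡ 0 → sumFin m g + h i ≡ sumFin m h
sumFin-+-missing (suc m) zero    {g} {h} g≡h gi≡0 = begin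
  g zero + sumFin m (λ x → g (suc x)) + h zero ≡⟨ cong (λ z → z + sumFin m (λ x → g (suc x)) + h zero) gi≡0 ⟩
  sumFin m (λ x → g (suc x)) + h zero          ≡⟨ +-comm _ (h zero) ⟩
  h zero + sumFin m (λ x → g (suc x))          ≡⟨ cong (h zero +_) (sumFin-cong m (λ x → g≡h (suc x) λ ())) ⟩
  h zero + sumFin m (λ x → h (suc x))          ∎
  where open ≡-Reasoning
sumFin-+-missing (suc m) (suc i) {g} {h} g≡h gi≡0 =
  trans (+-assoc (g zero) _ _)
        (cong₂ _+_ (g≡h zero λ ())
                   (sumFin-+-missing m i (λ j i≢j → g≡h (suc j) (λ e → i≢j (suc-injective e))) gi≡0))

indicator : {A : Set} → Dec A → ℕ
indicator d = if does d then 1 else 0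

count-sumFin : ∀ m {P : Fin m → Set} (P? : ∀ x → Dec (P x)) →
  count m P? ≡ sumFin m (λ x → indicator (P? x))
count-sumFin zero    P? = refl
count-sumFin (suc m) P? with P? zero
... | yes _ = cong suc (count-sumFin m (λ x → P? (suc x)))
... | no  _ = count-sumFin m (λ x → P? (suc x))

count-cong : ∀ m {P Q : Fin m → Set} (P? : ∀ x → Dec (P x)) (Q? : ∀ x → Dec (Q x)) →
  (∀ x → P x → Q x) → (∀ x → Q x → P x) → count m P? ≡ count m Q?
count-cong zero    P? Q? P⇒Q Q⇒P = refl
count-cong (suc m) P? Q? P⇒Q Q⇒P with P? zero | Q? zero
... | yes _  | yes _  = cong suc (count-cong m _ _ (λ x → P⇒Q (suc x)) (λ x → Q⇒P (suc x)))
... | no  _  | no  _  = count-cong m _ _ (λ x → P⇒Q (suc x)) (λ x → Q⇒P (suc x))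
... | yes p  | no ¬q  = ⊥-elim (¬q (P⇒Q zero p))
... | no ¬p  | yes q  = ⊥-elim (¬p (Q⇒P zero q))

count-none : ∀ m {P : Fin m → Set} (P? : ∀ x → Dec (P x)) → (∀ x → ¬ P x) → count m P? ≡ 0
count-none zero    P? ¬P = refl
count-none (suc m) P? ¬P with P? zero
... | yes p = ⊥-elim (¬P zero p)
... | no  _ = count-none m (λ x → P? (suc x)) (λ x → ¬P (suc x))

count-↑ : ∀ m k {P : Fin (m + k) → Set} (P? : ∀ x → Dec (P x)) →
  count (m + k) P? ≡ count m (λ x → P? (x ↑ˡ k)) + count k (λ x → P? (m ↑ʳ x))
count-↑ zero    k P? = refl
count-↑ (suc m) k P? with P? zero
... | yes _ = cong suc (count-↑ m k (λ x → P? (suc x)))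
... | no  _ = count-↑ m k (λ x → P? (suc x))

count-≡ : ∀ m (c : Fin m) → count m (λ x → x ≟ c) ≡ 1
count-≡ (suc m) zero    = cong suc (count-none m _ (λ x ()))
count-≡ (suc m) (suc c) =
  trans (count-cong m _ (λ x → x ≟ c) (λ x → suc-injective) (λ x → cong suc)) (count-≡ m c)

fibreSize : ∀ {m q} → (Fin m → Fin q) → Fin q → ℕ
fibreSize {m} f c = count m (λ b → f b ≟ c)

sumFin-fibreSize : ∀ q m (f : Fin m → Fin q) → sumFin q (fibreSize f) ≡ m
sumFin-fibreSize q m f = begin
  sumFin q (λ c → count m (λ b → f b ≟ c))                     ≡⟨ sumFin-cong q (λ c → count-sumFin m _) ⟩
  sumFin q (λ c → sumFin m (λ b → indicator (f b ≟ c)))        ≡⟨ sym (sumFin-swap m q _) ⟩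
  sumFin m (λ b → sumFin q (λ c → indicator (f b ≟ c)))        ≡⟨ sumFin-cong m (λ b → sym (count-sumFin q _)) ⟩
  sumFin m (λ b → count q (λ c → f b ≟ c))                     ≡⟨ sumFin-cong m (λ b → count-cong q _ _ (λ c → sym) (λ c → sym)) ⟩
  sumFin m (λ b → count q (λ c → c ≟ f b))                     ≡⟨ sumFin-cong m (λ b → count-≡ q (f b)) ⟩
  sumFin m (λ _ → 1)                                           ≡⟨ sumFin-const m 1 ⟩
  m * 1                                                        ≡⟨ *-comm m 1 ⟩
  m + 0                                                        ≡⟨ +-comm m 0 ⟩
  m                                                            ∎
  where open ≡-Reasoning

equalFibres⇒∣ : ∀ {q m d} (f : Fin m → Fin q) → (∀ c → fibreSize f c ≡ d) → q ∣ m
equalFibres⇒∣ {q} {m} {d} f fibres = divides d (begin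
  m                    ≡⟨ sym (sumFin-fibreSize q m f) ⟩
  sumFin q (fibreSize f) ≡⟨ sumFin-cong q fibres ⟩
  sumFin q (λ _ → d)   ≡⟨ sumFin-const q d ⟩
  q * d                ≡⟨ *-comm q d ⟩
  d * q                ∎)
  where open ≡-Reasoning

fibreSize-cong : ∀ {m q} {f g : Fin m → Fin q} → (∀ x → f x ≡ g x) → ∀ c → fibreSize f c ≡ fibreSize g c
fibreSize-cong {m} f≡g c =
  count-cong m _ _ (λ x e → trans (sym (f≡g x)) e) (λ x e → trans (f≡g x) e)

-- Colour the first q points with all colours once and recurse on the rest.
equalFibres : ∀ q d → Σ (Fin (d * q) → Fin q) (λ f → ∀ c → fibreSize f c ≡ d)
equalFibres q zero    = (λ ()) , λ c → refl
equalFibres q (suc d) = f , fibres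
  where
  g : Fin (d * q) → Fin q
  g = proj₁ (equalFibres q d)
  f : Fin (q + d * q) → Fin q
  f x = [ (λ y → y) , g ]′ (splitAt q x)
  fibres : ∀ c → fibreSize f c ≡ suc d
  fibres c = trans (count-↑ q (d * q) (λ b → f b ≟ c)) (cong₂ _+_
    (trans (fibreSize-cong (λ x → cong [ (λ y → y) , g ]′ (splitAt-↑ˡ q x (d * q))) c) (count-≡ q c))
    (trans (fibreSize-cong (λ x → cong [ (λ y → y) , g ]′ (splitAt-↑ʳ q (d * q) x)) c)
           (proj₂ (equalFibres q d) c)))

∣⇒equalFibres : ∀ q m → (q∣m : q ∣ m) →
  Σ (Fin m → Fin q) (λ f → ∀ c → fibreSize f c ≡ _∣_.quotient q∣m)
∣⇒equalFibres q .(d * q) (divides d refl) = equalFibres q d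

module _ {p : ℕ} {n : Fin p → ℕ} {q : ℕ} (col : Vertex p n → Fin q) where

  partCount : Fin p → Fin q → ℕ
  partCount i = fibreSize (λ b → col (i , b))

  colourCount : Fin q → ℕ
  colourCount c = sumFin p (λ j → partCount j c)

  nbrsOfColour-+-partCount : ∀ i a c →
    nbrsOfColour p n q col (i , a) c + partCount i c ≡ colourCount c
  nbrsOfColour-+-partCount i a c = sumFin-+-missing p i
    (λ j i≢j → count-cong (n j) _ _ (λ b → proj₂) (λ b e → i≢j , e))
    (count-none (n i) _ (λ b adj → proj₁ adj refl))

  equalParts⇒balanced : (d : Fin p → ℕ) → (∀ i c → partCount i c ≡ d i) →
    IsNBColouring p n q col
  equalParts⇒balanced d parts (i , a) c c′ = +-cancelʳ-≡ (d i) _ _ (begin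
    N c + d i             ≡⟨ cong (N c +_) (sym (parts i c)) ⟩
    N c + partCount i c   ≡⟨ nbrsOfColour-+-partCount i a c ⟩
    colourCount c         ≡⟨ sumFin-cong p (λ j → parts j c) ⟩
    sumFin p d            ≡⟨ sumFin-cong p (λ j → sym (parts j c′)) ⟩
    colourCount c′        ≡⟨ sym (nbrsOfColour-+-partCount i a c′) ⟩
    N c′ + partCount i c′ ≡⟨ cong (N c′ +_) (parts i c′) ⟩
    N c′ + d i            ∎)
    where
    open ≡-Reasoning
    N : Fin q → ℕ
    N = nbrsOfColour p n q col (i , a)

  module _ (balanced : IsNBColouring p n q col) (a : (i : Fin p) → Fin (n i)) where

    nbrsSum : Fin q → ℕ
    nbrsSum c = sumFin p (λ i → nbrsOfColour p n q col (i , a i) c)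

    nbrsSum-+-colourCount : ∀ c → nbrsSum c + colourCount c ≡ p * colourCount c
    nbrsSum-+-colourCount c = begin
      nbrsSum c + colourCount c ≡⟨ sym (sumFin-+ p _ _) ⟩
      sumFin p (λ i → nbrsOfColour p n q col (i , a i) c + partCount i c)
        ≡⟨ sumFin-cong p (λ i → nbrsOfColour-+-partCount i (a i) c) ⟩
      sumFin p (λ _ → colourCount c) ≡⟨ sumFin-const p (colourCount c) ⟩
      p * colourCount c ∎
      where open ≡-Reasoning

    balanced⇒equalColourCounts : 2 ≤ p → ∀ c c′ → colourCount c ≡ colourCount c′
    balanced⇒equalColourCounts (s≤s (s≤s {n = r} z≤n)) c c′ =
      *-cancelˡ-≡ (colourCount c) (colourCount c′) (suc r)
        (trans (sym (nbrsSum≡ c)) (trans (sumFin-cong p (λ i → balanced (i , a i) c c′)) (nbrsSum≡ c′)))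
      where
      nbrsSum≡ : ∀ c → nbrsSum c ≡ suc r * colourCount c
      nbrsSum≡ c = +-cancelˡ-≡ (colourCount c) _ _
        (trans (+-comm (colourCount c) (nbrsSum c)) (nbrsSum-+-colourCount c))

    balanced⇒equalParts : 2 ≤ p → ∀ i c c′ → partCount i c ≡ partCount i c′
    balanced⇒equalParts 2≤p i c c′ = +-cancelˡ-≡ (N c) _ _ (begin
      N c + partCount i c   ≡⟨ nbrsOfColour-+-partCount i (a i) c ⟩
      colourCount c         ≡⟨ balanced⇒equalColourCounts 2≤p c c′ ⟩
      colourCount c′        ≡⟨ sym (nbrsOfColour-+-partCount i (a i) c′) ⟩
      N c′ + partCount i c′ ≡⟨ cong (_+ partCount i c′) (balanced (i , a i) c′ c) ⟩
      N c + partCount i c′  ∎)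
      where
      open ≡-Reasoning
      N : Fin q → ℕ
      N = nbrsOfColour p n q col (i , a i)

balanced⇒∣ : ∀ {p} {n : Fin p → ℕ} {q} (col : Vertex p n → Fin q) → IsNBColouring p n q col →
  2 ≤ p → ((i : Fin p) → 1 ≤ n i) → (i : Fin p) → q ∣ n i
balanced⇒∣ {p} {n} col balanced 2≤p nonempty i =
  equalFibres⇒∣ (λ b → col (i , b)) (λ c → balanced⇒equalParts col balanced a 2≤p i c (col (i , a i)))
  where
  a : (i : Fin p) → Fin (n i)
  a i = fromℕ< (nonempty i)

∣⇒hasNBColouring : ∀ {p n q} → ((i : Fin p) → q ∣ n i) → HasNBColouring p n q
∣⇒hasNBColouring {p} {n} {q} q∣n = col , equalParts⇒balanced col (λ i → _∣_.quotient (q∣n i)) parts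
  where
  colourPart : (i : Fin p) → Σ (Fin (n i) → Fin q) (λ f → ∀ c → fibreSize f c ≡ _∣_.quotient (q∣n i))
  colourPart i = ∣⇒equalFibres q (n i) (q∣n i)
  col : Vertex p n → Fin q
  col (i , b) = proj₁ (colourPart i) b
  parts : ∀ i c → partCount col i c ≡ _∣_.quotient (q∣n i)
  parts i = proj₂ (colourPart i)

theorem2p6 : (k : ℕ) → 1 ≤ k → Prime (2 * k + 1) →
    (p : ℕ) → 2 ≤ p → (n : Fin p → ℕ) → ((i : Fin p) → 1 ≤ n i) →
    HasNBColouring p n (2 * k + 1) ⇔ ((i : Fin p) → (2 * k + 1) ∣ n i)
theorem2p6 k _ _ p 2≤p n nonempty =
  mk⇔ (λ (col , balanced) → balanced⇒∣ col balanced 2≤p nonempty) ∣⇒hasNBColouring
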